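{- Let $G^1$ be a 1-wconnected 1-graph with infinitely many boundary 1-nodes (not necessarily locally 1-finite), and let $^{*}G^1$ be its enlargement with respect to a free ultrafilter $\mathcal F$ on $\mathbb N$, with principal 1-galaxy $\Gamma_0^1$. If $^{*}G^1$ has a hypernode (of rank 0 or 1) that is not in $\Gamma_0^1$, then there exists a two-way infinite sequence of 1-galaxies totally ordered according to their closeness to $\Gamma_0^1$; that is, there are pairwise distinct 1-galaxies $\Gamma_i^1$, $i\in\mathbb Z$, such that $\Gamma_i^1$ is closer to $\Gamma_0^1$ than is $\Gamma_j^1$ whenever $i<j$.
   Context: Let $G^0=\{X^0,B\}$ be a graph with 0-nodes $X^0$ and branches $B$. A 0-tip is an equivalence class of one-ended paths of $G^0$ under eventual identity. Partition the 0-tips into subsets and add to each at most one 0-node (no 0-node added twice); the resulting sets are the 1-nodes, $X^1$, and $G^1=\{X^0,B,X^1\}$. A 0-walk is a finite or infinite alternating sequence of 0-nodes and branches, each branch incident to its neighbouring 0-nodes; a one-ended/endless 0-walk is extended if its tails are eventually one-ended paths, and then traverses their 0-tips. A 0-walk reaches a 1-node $x^1$ if it traverses a 0-tip in $x^1$ or terminates at a 0-node in $x^1$. A two-ended 1-walk is $\langle x_0,W_0^0,x_1^1,\dots,x_{m-1}^1,W_{m-1}^0,x_m\rangle$ ($m\ge1$) with internal terms 1-nodes, each $W_k^0$ a nontrivial 0-walk reaching its two neighbouring nodes, each internal $x_k^1$ reached through a 0-tip by at least one of $W_{k-1}^0,W_k^0$. $G^1$ is 1-wconnected if every two nodes are reached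 by some 0-walk or 1-walk. 0-sections are subgraphs of $G^0$ induced by maximal sets of branches pairwise connected by paths; a boundary 1-node is incident (contains a 0-node of a branch of, or a 0-tip with a representative path in) at least two 0-sections. Lengths: finite 0-walk = number of branch traversals, extended one-ended 0-walk $=\omega$, extended endless $=\omega\cdot2$, two-ended 1-walk = natural sum of its 0-walk lengths. The wdistance $d(x,y)<\omega^2$ is the minimum length of a two-ended walk terminating at $x,y$. Enlargement: 0-hypernodes (1-hypernodes) are classes $[x_n]$ of sequences of 0-nodes (1-nodes) modulo $\langle x_n\rangle\sim\langle y_n\rangle$ iff $\{n:x_n=y_n\}\in\mathcal F$; standard hypernodes have constant representatives; hyperbranches are classes $[\{x_n,y_n\}]$ with $\{n:\{x_n,y_n\}\in B\}\in\mathcal F$. Hypernodes $[x_n],[y_n]$ are 1-limitedly distant if $\{n:d(x_n,y_n)\le\omega\cdot k\}\in\mathcal F$ for some $k\in\mathbb N$; classes are nodal 1-galaxies; a 1-galaxy is a nodal 1-galaxy with all hyperbranches whose both 0-hypernodes lie in it; $\Gamma_0^1$ contains the standard hypernodes. For ordinals $\alpha,\beta<\omega^2$, "$\alpha-\beta\ge\omega\cdot m$" means $\alpha\ge\beta\oplus\omega\cdot m$ with $\oplus$ the natural sum. For 1-galaxies $\Gamma_a^1,\Gamma_b^1$ different from $\Gamma_0^1$, $\Gamma_a^1$ is closer to $\Gamma_0^1$ than is $\Gamma_b^1$ if there are $\mathbf y=[y_n]$ in $\Gamma_a^1$, $\mathbf z=[z_n]$ in $\Gamma_b^1$, $\mathbf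 x=[x_n]$ in $\Gamma_0^1$ with $\{n:d(z_n,x_n)-d(y_n,x_n)\ge\omega\cdot m\}\in\mathcal F$ for every $m\in\mathbb N$. -}

module Defs where

open import Data.Nat using (ℕ; zero; suc; _+_; _≤_; _<_; z≤n)
open import Data.Integer using (ℤ) renaming (_<_ to _<ℤ_)
open import Data.Product using (Σ; Σ-syntax; _×_; _,_; proj₁; proj₂)
open import Data.Sum using (_⊎_; inj₁; inj₂)
open import Data.Unit using (⊤)
open import Data.Empty using (⊥)
open import Data.List using (List; []; _∷_)
open import Data.List.Membership.Propositional using (_∈_)
open import Data.List.Relation.Unary.Unique.Propositional using (Unique)
open import Relation.Nullary using (¬_)
open import Relation.Binary.PropositionalEquality using (_≡_; _≢_)

-- Ordinals below ω² : (a , b) stands for ω·a + b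

Ord : Set
Ord = ℕ × ℕ

-- natural (Hessenberg) sum
_⊕_ : Ord → Ord → Ord
(a , b) ⊕ (c , d) = (a + c , b + d)

ω· : ℕ → Ord
ω· m = (m , 0)

_≤o_ : Ord → Ord → Set
(a , b) ≤o (c , d) = (a < c) ⊎ ((a ≡ c) × (b ≤ d))

record FreeUltrafilter : Set₁ where
  field
    mem      : (ℕ → Set) → Set
    mem-univ : mem (λ _ → ⊤)
    mem-∅    : ¬ mem (λ _ → ⊥)
    mem-sup  : (A B : ℕ → Set) → (∀ n → A n → B n) → mem A → mem B
    mem-∩    : (A B : ℕ → Set) → mem A → mem B → mem (λ n → A n × B n)
    ultra    : (A : ℕ → Set) → mem A ⊎ mem (λ n → ¬ A n)
    free     : (k : ℕ) → ¬ mem (λ n → n ≡ k)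

-- 0-graphs: branches are two-element sets {x , y} of 0-nodes

record Graph0 : Set₁ where
  field
    X0      : Set
    Adj     : X0 → X0 → Set
    Adj-sym : ∀ {x y} → Adj x y → Adj y x
    Adj-irr : ∀ {x} → ¬ Adj x x

module G0Defs (G : Graph0) where
  open Graph0 G

  Injective : (ℕ → X0) → Set
  Injective s = ∀ i j → s i ≡ s j → i ≡ j

  record OEPath : Set where
    field
      seq : ℕ → X0
      adj : ∀ n → Adj (seq n) (seq (suc n))
      inj : Injective seq
  open OEPath public

  -- eventual identity of one-ended paths (same 0-tip)
  _~tip_ : OEPath → OEPath → Set
  p ~tip q = Σ ℕ λ i → Σ ℕ λ j → ∀ k → seq p (k + i) ≡ seq q (k + j)

  data FinWalk : X0 → X0 → ℕ → Set where
    triv : ∀ a → FinWalk a a 0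
    step : ∀ {a b c k} → Adj a b → FinWalk b c k → FinWalk a c (suc k)

  nodesF : ∀ {a b k} → FinWalk a b k → List X0
  nodesF (triv a) = a ∷ []
  nodesF (step {a = a} _ w) = a ∷ nodesF w

  FinPath : X0 → X0 → Set
  FinPath a b = Σ ℕ λ k → Σ (FinWalk a b k) λ w → Unique (nodesF w)

  Branch : Set
  Branch = Σ X0 λ u → Σ X0 λ v → Adj u v

  end₁ end₂ : Branch → X0
  end₁ b = proj₁ b
  end₂ b = proj₁ (proj₂ b)

  -- two branches lie in the same 0-section
  Conn : Branch → Branch → Set
  Conn b b' = Σ X0 λ u → Σ X0 λ u' →
              ((u ≡ end₁ b) ⊎ (u ≡ end₂ b)) × ((u' ≡ end₁ b') ⊎ (u' ≡ end₂ b')) × FinPath u u'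

  pathBranch : OEPath → ℕ → Branch
  pathBranch p n = seq p n , seq p (suc n) , adj p n

record Graph1 (G : Graph0) : Set₁ where
  open Graph0 G
  open G0Defs G
  field
    X1        : Set
    tipOf     : OEPath → X1                        -- the 1-node containing the 0-tip of p
    tip-resp  : ∀ p q → p ~tip q → tipOf p ≡ tipOf q
    tip-onto  : ∀ (x : X1) → Σ OEPath λ p → tipOf p ≡ x  -- partition blocks nonempty
    emb       : X0 → X1 → Set                       -- 0-node added to 1-node
    emb-func  : ∀ {u x y} → emb u x → emb u y → x ≡ y
    emb-atmost1 : ∀ {u v x} → emb u x → emb v x → u ≡ v

module G1Defs {G : Graph0} (H : Graph1 G) where
  open Graph0 G
  open G0Defs G
  open Graph1 H

  Node : Set
  Node = X0 ⊎ X1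

  IsOne : Node → Set
  IsOne y = Σ X1 λ x → y ≡ inj₂ x

  record Ray : Set where
    field
      rseq     : ℕ → X0
      radj     : ∀ n → Adj (rseq n) (rseq (suc n))
      extended : Σ ℕ λ N → Injective (λ k → rseq (k + N))
  open Ray public

  tailPath : (r : Ray) (N : ℕ) → Injective (λ k → rseq r (k + N)) → OEPath
  tailPath r N i = record { seq = λ k → rseq r (k + N) ; adj = λ k → radj r (k + N) ; inj = i }

  TraversesIn : Ray → X1 → Set
  TraversesIn r x = Σ ℕ λ N → Σ (Injective (λ k → rseq r (k + N))) λ i → tipOf (tailPath r N i) ≡ x

  ReachTip : Ray → Node → Set
  ReachTip r (inj₁ _) = ⊥
  ReachTip r (inj₂ x) = TraversesIn r x

  ReachFin : X0 → Node → Set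
  ReachFin a (inj₁ b) = a ≡ b
  ReachFin a (inj₂ x) = emb a x

  data Walk0 : Set where
    fin     : ∀ {a b k} → FinWalk a b k → Walk0
    rayR    : Ray → Walk0              -- starts at rseq 0, infinite at its finish
    rayL    : Ray → Walk0              -- infinite at its start, finishes at rseq 0
    endless : (r s : Ray) → rseq r 0 ≡ rseq s 0 → Walk0   -- reverse of r, then s

  len0 : Walk0 → Ord
  len0 (fin {k = k} _) = (0 , k)
  len0 (rayR _) = ω· 1
  len0 (rayL _) = ω· 1
  len0 (endless _ _ _) = ω· 2

  Nontriv : Walk0 → Set
  Nontriv (fin {k = k} _) = 1 ≤ k
  Nontriv _ = ⊤

  StartR EndR StartTip EndTip : Walk0 → Node → Set
  StartR (fin {a = a} _) y = ReachFin a y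
  StartR (rayR r) y = ReachFin (rseq r 0) y
  StartR (rayL r) y = ReachTip r y
  StartR (endless r s _) y = ReachTip r y
  EndR (fin {b = b} _) y = ReachFin b y
  EndR (rayR r) y = ReachTip r y
  EndR (rayL r) y = ReachFin (rseq r 0) y
  EndR (endless r s _) y = ReachTip s y
  StartTip (rayL r) y = ReachTip r y
  StartTip (endless r s _) y = ReachTip r y
  StartTip _ y = ⊥
  EndTip (rayR r) y = ReachTip r y
  EndTip (endless r s _) y = ReachTip s y
  EndTip _ y = ⊥

  -- validity of the 1-walk ⟨x , W , y , W₁ , z₁ , …⟩
  Valid1 : Node → Walk0 → Node → List (Walk0 × Node) → Set
  Valid1 x W y [] = Nontriv W × StartR W x × EndR W y
  Valid1 x W y ((W' , z) ∷ rest) =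
    Nontriv W × StartR W x × EndR W y × IsOne y × (EndTip W y ⊎ StartTip W' y) × Valid1 y W' z rest

  final : Node → List (Walk0 × Node) → Node
  final y [] = y
  final _ ((_ , z) ∷ rest) = final z rest

  sumLen : List (Walk0 × Node) → Ord
  sumLen [] = (0 , 0)
  sumLen ((W , _) ∷ rest) = len0 W ⊕ sumLen rest

  data Walk2 : Node → Node → Set where
    trivial : ∀ x → Walk2 x x
    zeroW   : ∀ {a b k} → FinWalk a b k → Walk2 (inj₁ a) (inj₁ b)
    oneW    : ∀ {x z} (W : Walk0) (y : Node) (rest : List (Walk0 × Node)) →
              Valid1 x W y rest → final y rest ≡ z → Walk2 x z

  len2 : ∀ {x y} → Walk2 x y → Ord
  len2 (trivial _) = (0 , 0)
  len2 (zeroW {k = k} _) = (0 , k)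
  len2 (oneW W _ rest _ _) = len0 W ⊕ sumLen rest

  IsDist : Node → Node → Ord → Set
  IsDist x y α = (Σ (Walk2 x y) λ w → len2 w ≡ α) × (∀ (w : Walk2 x y) → α ≤o len2 w)

  Wconnected : Set
  Wconnected = ∀ (x y : Node) → Walk2 x y

  Incident : X1 → Branch → Set
  Incident x b =
    (Σ Branch λ b' → Conn b b' × (emb (end₁ b') x ⊎ emb (end₂ b') x))
    ⊎ (Σ OEPath λ p → (tipOf p ≡ x) × (∀ n → Conn b (pathBranch p n)))

  Boundary : X1 → Set
  Boundary x = Σ Branch λ b₁ → Σ Branch λ b₂ → ¬ Conn b₁ b₂ × Incident x b₁ × Incident x b₂

  InfinitelyManyBoundary : Set
  InfinitelyManyBoundary = ∀ (l : List X1) → Σ X1 λ x → Boundary x × ¬ (x ∈ l)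

  module Enlargement (F : FreeUltrafilter) where
    open FreeUltrafilter F

    -- hypernodes of rank 0 or 1 (representative sequences)
    HyperNode : Set
    HyperNode = (ℕ → X0) ⊎ (ℕ → X1)

    at : HyperNode → ℕ → Node
    at (inj₁ s) n = inj₁ (s n)
    at (inj₂ s) n = inj₂ (s n)

    standard : Node → HyperNode
    standard (inj₁ u) = inj₁ (λ _ → u)
    standard (inj₂ x) = inj₂ (λ _ → x)

    LimDist : HyperNode → HyperNode → Set
    LimDist h h' = Σ ℕ λ k → mem (λ n → Σ Ord λ α → IsDist (at h n) (at h' n) α × α ≤o ω· k)

    InΓ₀ : HyperNode → Set
    InΓ₀ h = Σ Node λ v → LimDist (standard v) h

    Closer : HyperNode → HyperNode → Set
    Closer ga gb = Σ HyperNode λ y → Σ HyperNode λ z → Σ HyperNode λ x →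
      LimDist y ga × LimDist z gb × InΓ₀ x ×
      (∀ (m : ℕ) → mem (λ n → Σ Ord λ α → Σ Ord λ β →
         IsDist (at z n) (at x n) α × IsDist (at y n) (at x n) β × (β ⊕ ω· m) ≤o α))

-- Fix a standard node o. Since h is outside Γ₀, for every k the walks from hₙ to o
-- have length at least ω·k for F-almost all n. Consecutive 1-nodes of a 1-walk lie
-- within ω·2 of each other, so any t with d(hₙ, o) ≥ ω·(t + 3) is matched by a 1-node
-- on a walk from hₙ to o at distance in [ω·t, ω·(t + 3)) from o. Let sₙ be the largest s
-- with d(hₙ, o) ≥ ω·4s²; then sₙ → ∞ along F. Taking for each i ∈ ℤ the 1-node at
-- distance about ω·sₙ(sₙ + i) gives hypernodes Γᵢ whose mutual distances and distances
-- to Γ₀ grow like ω·sₙ, hence are not limited, and whose distances to o increase with i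
-- by more than any ω·m.
--
-- Distances exist only under double negation here; the decisions the construction
-- needs come from the ultrafilter, which yields weak excluded middle.

module Submission where

open import Defs
open import Data.Integer using (ℤ; +_; -[1+_]; ∣_∣) renaming (_<_ to _<ℤ_)
open import Data.Integer.Base using (-<-; -<+; +<+)
import Data.Integer.Properties as ℤ
open import Data.Nat using (ℕ; zero; suc; _+_; _*_; _∸_; _≤_; _<_; z≤n; s≤s; z<s; _≤?_)
open import Data.Nat.Properties
open import Data.Nat.Induction using (<-rec)
open import Data.Product using (Σ; _×_; _,_; proj₁; proj₂)
open import Data.Sum using (_⊎_; inj₁; inj₂; map₁; map₂)
open import Data.Unit using (tt)
open import Data.Empty using (⊥-elim)
open import Data.List using (List; []; _∷_)
open import Function using (_∘_)
open import Relation.Nullary using (¬_; Dec; yes; no)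
open import Relation.Nullary.Decidable using (decidable-stable)
open import Relation.Unary using (Decidable)
open import Relation.Binary using (tri<; tri≈; tri>)
open import Relation.Binary.PropositionalEquality using (_≡_; _≢_; refl; sym; trans; cong; cong₂; subst)

lead : Ord → ℕ
lead = proj₁

≤o-refl : ∀ {α} → α ≤o α
≤o-refl = inj₂ (refl , ≤-refl)

≤o-reflexive : ∀ {α β} → α ≡ β → α ≤o β
≤o-reflexive refl = ≤o-refl

≤o-trans : ∀ {α β γ} → α ≤o β → β ≤o γ → α ≤o γ
≤o-trans (inj₁ p) (inj₁ q) = inj₁ (<-trans p q)
≤o-trans (inj₁ p) (inj₂ (refl , _)) = inj₁ p
≤o-trans (inj₂ (refl , _)) (inj₁ q) = inj₁ q
≤o-trans (inj₂ (refl , p)) (inj₂ (refl , q)) = inj₂ (refl , ≤-trans p q)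

≤o⇒lead≤ : ∀ {α β} → α ≤o β → lead α ≤ lead β
≤o⇒lead≤ (inj₁ p) = <⇒≤ p
≤o⇒lead≤ (inj₂ (refl , _)) = ≤-refl

0≤o : ∀ α → (0 , 0) ≤o α
0≤o (zero , b) = inj₂ (refl , z≤n)
0≤o (suc a , b) = inj₁ (s≤s z≤n)

⊕-mono-≤o : ∀ {α β γ δ} → α ≤o β → γ ≤o δ → (α ⊕ γ) ≤o (β ⊕ δ)
⊕-mono-≤o (inj₁ p) q = inj₁ (+-mono-<-≤ p (≤o⇒lead≤ q))
⊕-mono-≤o {a , _} (inj₂ (refl , p)) (inj₁ q) = inj₁ (+-monoʳ-< a q)
⊕-mono-≤o (inj₂ (refl , p)) (inj₂ (refl , q)) = inj₂ (refl , +-mono-≤ p q)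

⊕-identityʳ : ∀ α → α ⊕ (0 , 0) ≡ α
⊕-identityʳ (a , b) = cong₂ _,_ (+-identityʳ a) (+-identityʳ b)

⊕-assoc : ∀ α β γ → (α ⊕ β) ⊕ γ ≡ α ⊕ (β ⊕ γ)
⊕-assoc (a , b) (c , d) (e , f) = cong₂ _,_ (+-assoc a c e) (+-assoc b d f)

⊕-comm : ∀ α β → α ⊕ β ≡ β ⊕ α
⊕-comm (a , b) (c , d) = cong₂ _,_ (+-comm a c) (+-comm b d)

¬¬-least : (P : ℕ → Set) → ∀ {n} → P n → ¬ ¬ Σ ℕ λ m → P m × (∀ k → P k → m ≤ k)
¬¬-least P {n} pn no-least = <-rec (λ n → ¬ P n) none-below n pn
  where
  none-below : ∀ n → (∀ {k} → k < n → ¬ P k) → ¬ P n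
  none-below n below pn = no-least (n , pn , λ k pk → ≮⇒≥ λ k<n → below k<n pk)

greatest≤ : (P : ℕ → Set) → Decidable P → P 0 → (B : ℕ) →
            Σ ℕ λ a → P a × (∀ t → P t → t ≤ B → t ≤ a)
greatest≤ P P? p₀ zero = 0 , p₀ , λ _ _ t≤0 → t≤0
greatest≤ P P? p₀ (suc B) with P? (suc B)
... | yes p = suc B , p , λ _ _ t≤B → t≤B
... | no ¬p with greatest≤ P P? p₀ B
...   | a , pa , maximal =
  a , pa , λ t pt t≤1+B → maximal t pt (≤-pred (≤∧≢⇒< t≤1+B λ { refl → ¬p pt }))

Spacious : ℤ → ℕ → Set
Spacious i s = 2 + ∣ i ∣ ≤ s

-- s + i, truncation-free as long as ∣ i ∣ < s
shift : ℕ → ℤ → ℕ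
shift s (+ n) = s + n
shift s -[1+ n ] = s ∸ suc n

radius : ℕ → ℤ → ℕ
radius s i = s * shift s i

spacious⇒< : ∀ i {s} → Spacious i s → ∣ i ∣ < s
spacious⇒< i = ≤-trans (n≤1+n (suc ∣ i ∣))

shift-positive : ∀ {s} i → Spacious i s → 1 ≤ shift s i
shift-positive {s} (+ n) sp = ≤-trans (≤-trans (s≤s z≤n) sp) (m≤m+n s n)
shift-positive i@(-[1+ _ ]) sp = m<n⇒0<n∸m (spacious⇒< i sp)

shift≤2s : ∀ {s} i → Spacious i s → shift s i ≤ s + s
shift≤2s {s} i@(+ _) sp = +-monoʳ-≤ s (<⇒≤ (spacious⇒< i sp))
shift≤2s {s} -[1+ n ] sp = ≤-trans (m∸n≤m s (suc n)) (m≤m+n s s)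

shift-< : ∀ {s i j} → i <ℤ j → Spacious i s → shift s i < shift s j
shift-< {s} (+<+ m<n) sp = +-monoʳ-< s m<n
shift-< {s} { -[1+ m ]} {+ n} -<+ sp =
  ≤-trans (∸-monoʳ-< {s} {suc m} {0} z<s (<⇒≤ (spacious⇒< -[1+ m ] sp))) (m≤m+n s n)
shift-< {s} {i} (-<- n<m) sp = ∸-monoʳ-< (s≤s n<m) (<⇒≤ (spacious⇒< i sp))

s≤radius : ∀ {s} i → Spacious i s → s ≤ radius s i
s≤radius {s} i sp = subst (_≤ radius s i) (*-identityʳ s) (*-monoʳ-≤ s (shift-positive i sp))

radius-bounded : ∀ {s} i → Spacious i s → 3 + radius s i ≤ 4 * (s * s)
radius-bounded {s} i sp = begin
  3 + radius s i                ≤⟨ +-mono-≤ 3≤s² (*-monoʳ-≤ s (shift≤2s i sp)) ⟩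
  s * s + s * (s + s)           ≡⟨ cong (_+_ (s * s)) (*-distribˡ-+ s s s) ⟩
  s * s + (s * s + s * s)       ≤⟨ +-monoʳ-≤ (s * s) (+-monoʳ-≤ (s * s) (m≤m+n (s * s) (s * s + 0))) ⟩
  4 * (s * s)                   ∎
  where
  open ≤-Reasoning
  2≤s : 2 ≤ s
  2≤s = ≤-trans (s≤s (s≤s z≤n)) sp
  3≤s² : 3 ≤ s * s
  3≤s² = ≤-trans (s≤s (s≤s (s≤s z≤n))) (*-mono-≤ 2≤s 2≤s)

radius-separated : ∀ {s k i j} → i <ℤ j → Spacious i s → k + 3 ≤ s → k + (3 + radius s i) ≤ radius s j
radius-separated {s} {k} {i} {j} i<j sp k+3≤s = begin
  k + (3 + radius s i)    ≡⟨ +-assoc k 3 (radius s i) ⟨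
  k + 3 + radius s i      ≤⟨ +-monoˡ-≤ (radius s i) k+3≤s ⟩
  s + radius s i          ≡⟨ *-suc s (shift s i) ⟨
  s * suc (shift s i)     ≤⟨ *-monoʳ-≤ s (shift-< i<j sp) ⟩
  radius s j              ∎
  where open ≤-Reasoning

n≤4n² : ∀ n → n ≤ 4 * (n * n)
n≤4n² zero = z≤n
n≤4n² (suc n) = ≤-trans (m≤m+n (suc n) (n * suc n)) (m≤m+n (suc n * suc n) (3 * (suc n * suc n)))

module Ultrafilter (F : FreeUltrafilter) where
  open FreeUltrafilter F

  mem-mono : ∀ {A B : ℕ → Set} → mem A → (∀ n → A n → B n) → mem B
  mem-mono {A} {B} a A⊆B = mem-sup A B A⊆B a

  mem-∧ : ∀ {A B : ℕ → Set} → mem A → mem B → mem (λ n → A n × B n)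
  mem-∧ {A} {B} = mem-∩ A B

  mem-inhabited : ∀ {A : ℕ → Set} → mem A → ¬ (∀ n → ¬ A n)
  mem-inhabited {A} a empty = mem-∅ (mem-sup A _ empty a)

  ¬mem∁⇒mem : (P : ℕ → Set) → ¬ mem (λ n → ¬ P n) → mem P
  ¬mem∁⇒mem P ¬mem∁ with ultra P
  ... | inj₁ p = p
  ... | inj₂ ∁p = ⊥-elim (¬mem∁ ∁p)

  -- The ultrafilter decides the constant set with value P.
  weak-excluded-middle : (P : Set) → ¬ P ⊎ ¬ ¬ P
  weak-excluded-middle P with ultra (λ _ → P)
  ... | inj₁ p = inj₂ λ ¬p → mem-inhabited p λ _ → ¬p
  ... | inj₂ ¬p = inj₁ λ p → mem-inhabited ¬p λ _ ¬p → ¬p p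

module Walks {G : Graph0} (H : Graph1 G) where
  open Graph0 G
  open G0Defs G
  open Graph1 H
  open G1Defs H

  snocFin : ∀ {a b c k} → FinWalk a b k → Adj b c → FinWalk a c (suc k)
  snocFin (triv a) e = step e (triv _)
  snocFin (step e w) e' = step e (snocFin w e')

  reverseFin : ∀ {a b k} → FinWalk a b k → FinWalk b a k
  reverseFin (triv a) = triv a
  reverseFin (step e w) = snocFin (reverseFin w) (Adj-sym e)

  appendFin : ∀ {a b c k l} → FinWalk a b k → FinWalk b c l → FinWalk a c (k + l)
  appendFin (triv a) g = g
  appendFin (step e f) g = step e (appendFin f g)

  consSeq : X0 → (ℕ → X0) → ℕ → X0
  consSeq a f zero = a
  consSeq a f (suc n) = f n

  consSeq-shift : ∀ a f k N → consSeq a f (k + suc N) ≡ f (k + N)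
  consSeq-shift a f k N = cong (consSeq a f) (+-suc k N)

  consSeq-injective : ∀ {a f N} → Injective (λ k → f (k + N)) → Injective (λ k → consSeq a f (k + suc N))
  consSeq-injective {a} {f} {N} inj p q eq =
    inj p q (trans (sym (consSeq-shift a f p N)) (trans eq (consSeq-shift a f q N)))

  _⊆-tips_ : Ray → Ray → Set
  r ⊆-tips r' = ∀ x → TraversesIn r x → TraversesIn r' x

  consRay : ∀ {a} (r : Ray) → Adj a (rseq r 0) → Ray
  consRay {a} r e = record
    { rseq = consSeq a (rseq r)
    ; radj = λ { zero → e ; (suc n) → radj r n }
    ; extended = suc (proj₁ (extended r)) , consSeq-injective (proj₂ (extended r)) }

  consRay-⊆-tips : ∀ {a} (r : Ray) (e : Adj a (rseq r 0)) → r ⊆-tips consRay r e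
  consRay-⊆-tips {a} r e x (N , inj , tip≡x) =
    suc N , consSeq-injective inj , trans (tip-resp _ _ (0 , 0 , λ k → consSeq-shift a (rseq r) (k + 0) N)) tip≡x

  prependFin : ∀ {a b k} → FinWalk a b k → (r : Ray) → rseq r 0 ≡ b →
               Σ Ray λ r' → rseq r' 0 ≡ a × r ⊆-tips r'
  prependFin (triv a) r r₀≡a = r , r₀≡a , λ _ t → t
  prependFin {a} (step e w) r r₀≡c with prependFin w r r₀≡c
  ... | r' , r'₀≡b , r⊆r' =
    consRay r' (subst (Adj a) (sym r'₀≡b) e) , refl , λ x t → consRay-⊆-tips r' _ x (r⊆r' x t)

  ⊆-tips-reach : ∀ {r r'} → r ⊆-tips r' → ∀ u → ReachTip r u → ReachTip r' u
  ⊆-tips-reach r⊆r' (inj₂ x) t = r⊆r' x t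

  reachFin-subst : ∀ {a a'} u → a ≡ a' → ReachFin a u → ReachFin a' u
  reachFin-subst u refl p = p

  _startsLike_ _endsLike_ : Walk0 → Walk0 → Set
  V startsLike W = (∀ u → StartR W u → StartR V u) × (∀ u → StartTip W u → StartTip V u)
  V endsLike W = (∀ u → EndR W u → EndR V u) × (∀ u → EndTip W u → EndTip V u)

  Join : Walk0 → Walk0 → Set
  Join W W' = Σ Walk0 λ V → Nontriv V × V startsLike W × V endsLike W' × len0 V ≤o (len0 W ⊕ len0 W')

  join : (W W' : Walk0) (b : X0) → EndR W (inj₁ b) → StartR W' (inj₁ b) → Nontriv W → Join W W'
  join (fin {k = k} f) (fin {k = l} g) b refl refl 1≤k =
    fin (appendFin f g) , ≤-trans 1≤k (m≤m+n k l) , ((λ _ s → s) , λ _ ()) , ((λ _ e → e) , λ _ ()) , ≤o-refl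
  join (fin f) (rayR r) b refl r₀≡b _ with prependFin f r r₀≡b
  ... | r' , r'₀≡a , r⊆r' =
    rayR r' , tt , ((λ u s → reachFin-subst u (sym r'₀≡a) s) , λ _ ()) ,
    (⊆-tips-reach r⊆r' , ⊆-tips-reach r⊆r') , inj₂ (refl , z≤n)
  join (rayL r) (fin g) b r₀≡b refl _ with prependFin (reverseFin g) r r₀≡b
  ... | r' , r'₀≡c , r⊆r' =
    rayL r' , tt , (⊆-tips-reach r⊆r' , ⊆-tips-reach r⊆r') ,
    ((λ u e → reachFin-subst u (sym r'₀≡c) e) , λ _ ()) , inj₂ (refl , z≤n)
  join (rayL r) (rayR s) b r₀≡b s₀≡b _ =
    endless r s (trans r₀≡b (sym s₀≡b)) , tt ,
    ((λ _ s → s) , λ _ s → s) , ((λ _ e → e) , λ _ e → e) , ≤o-refl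
  join (fin f) (rayL r) b _ () _
  join (fin f) (endless r s _) b _ () _
  join (rayL r) (rayL r') b _ () _
  join (rayL r) (endless r' s _) b _ () _
  join (rayR r) W' b () _ _
  join (endless r s _) W' b () _ _

  endTip-or-embedded : (W : Walk0) (x : X1) → EndR W (inj₂ x) →
                       EndTip W (inj₂ x) ⊎ Σ X0 λ b → emb b x × EndR W (inj₁ b)
  endTip-or-embedded (fin {b = b} f) x e = inj₂ (b , e , refl)
  endTip-or-embedded (rayR r) x e = inj₁ e
  endTip-or-embedded (rayL r) x e = inj₂ (rseq r 0 , e , refl)
  endTip-or-embedded (endless r s _) x e = inj₁ e

  startTip-or-embedded : (W : Walk0) (x : X1) → StartR W (inj₂ x) →
                         StartTip W (inj₂ x) ⊎ Σ X0 λ b → emb b x × StartR W (inj₁ b)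
  startTip-or-embedded (fin {a = a} f) x s = inj₂ (a , s , refl)
  startTip-or-embedded (rayR r) x s = inj₂ (rseq r 0 , s , refl)
  startTip-or-embedded (rayL r) x s = inj₁ s
  startTip-or-embedded (endless r _ _) x s = inj₁ s

  Valid1-head : ∀ {x W y} rest → Valid1 x W y rest → Valid1 x W y []
  Valid1-head [] v = v
  Valid1-head (_ ∷ _) (n , s , e , _) = n , s , e

  Valid1-replaceHead : ∀ {x y W y'} rest → Valid1 y W y' rest → (V : Walk0) → Nontriv V → StartR V x →
                       V endsLike W → Valid1 x V y' rest
  Valid1-replaceHead [] (_ , _ , e) V n s (ends , _) = n , s , ends _ e
  Valid1-replaceHead (_ ∷ _) (_ , _ , e , one , tip , v) V n s (ends , endTips) =
    n , s , ends _ e , one , map₁ (endTips _) tip , v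

  record Chain (x z : Node) : Set where
    constructor chain
    field
      first : Walk0
      next  : Node
      rest  : List (Walk0 × Node)
      valid : Valid1 x first next rest
      ends  : final next rest ≡ z

  chainLen : ∀ {x z} → Chain x z → Ord
  chainLen (chain W _ rest _ _) = len0 W ⊕ sumLen rest

  toWalk2 : ∀ {x z} → Chain x z → Walk2 x z
  toWalk2 (chain W y rest v e) = oneW W y rest v e

  -- A chain whose first 0-walk still starts through every 0-tip W does, so that it can
  -- replace W right after an internal 1-node.
  Extension : ∀ {x z} → Walk0 → Ord → Set
  Extension {x} {z} W L = Σ (Chain x z) λ c → (∀ u → StartTip W u → StartTip (Chain.first c) u) × chainLen c ≤o L

  prefixLen : ∀ L M → (L ⊕ M) ≤o ((L ⊕ (0 , 0)) ⊕ M)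
  prefixLen L M = ≤o-reflexive (cong (_⊕ M) (sym (⊕-identityʳ L)))

  joinChain : ∀ {x z} (W : Walk0) (b : X0) → Nontriv W → StartR W x → EndR W (inj₁ b) →
              (c : Chain (inj₁ b) z) → Extension {x} {z} W (len0 W ⊕ chainLen c)
  joinChain W b n s e (chain W' y' rest' v' e') with join W W' b e (proj₁ (proj₂ (Valid1-head rest' v'))) n
  ... | V , nV , (starts , startTips) , endsLikeW' , lenV =
    chain V y' rest' (Valid1-replaceHead rest' v' V nV (starts _ s) endsLikeW') e' , startTips ,
    ≤o-trans (⊕-mono-≤o lenV ≤o-refl) (≤o-reflexive (⊕-assoc (len0 W) (len0 W') (sumLen rest')))

  passThrough : ∀ {x₀ x z} (W : Walk0) → Valid1 x₀ W (inj₂ x) [] → (c : Chain (inj₂ x) z) →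
                EndTip W (inj₂ x) ⊎ StartTip (Chain.first c) (inj₂ x) → Extension {x₀} {z} W (len0 W ⊕ chainLen c)
  passThrough W (n , s , e) (chain W' y' rest' v' e') tip =
    chain W _ ((W' , y') ∷ rest') (n , s , e , (_ , refl) , tip , v') e' , (λ _ t → t) , ≤o-refl

  -- At a 1-node the walks either pass through a 0-tip, or both reach its unique embedded
  -- 0-node and are joined there.
  catHop : ∀ {x y z} (W : Walk0) → Valid1 x W y [] → (c : Chain y z) → Extension {x} {z} W (len0 W ⊕ chainLen c)
  catHop {y = inj₁ b} W (n , s , e) c = joinChain W b n s e c
  catHop {y = inj₂ x} W v@(n , s , e) c@(chain W' y' rest' v' e')
    with endTip-or-embedded W x e | startTip-or-embedded W' x (proj₁ (proj₂ (Valid1-head rest' v')))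
  ... | inj₁ t | _ = passThrough W v c (inj₁ t)
  ... | inj₂ _ | inj₁ t = passThrough W v c (inj₂ t)
  ... | inj₂ (b , b∈x , eb) | inj₂ (b' , b'∈x , sb') =
    joinChain W b n s eb (chain W' y' rest' v'' e')
    where
    v'' : Valid1 (inj₁ b) W' y' rest'
    v'' = Valid1-replaceHead rest' v' W' (proj₁ (Valid1-head rest' v'))
            (subst (λ a → StartR W' (inj₁ a)) (emb-atmost1 b'∈x b∈x) sb') ((λ _ e → e) , λ _ t → t)

  catChain : ∀ {x m z} (W : Walk0) (y : Node) (rest : List (Walk0 × Node)) →
             Valid1 x W y rest → final y rest ≡ m →
             (c : Chain m z) → Extension {x} {z} W ((len0 W ⊕ sumLen rest) ⊕ chainLen c)
  catChain W y [] v refl c with catHop W v c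
  ... | c* , tips , len = c* , tips , ≤o-trans len (prefixLen (len0 W) (chainLen c))
  catChain W y ((W₁ , y₁) ∷ rest) (n , s , e , one , tip , v) fe c with catChain W₁ y₁ rest v fe c
  ... | chain W* y* rest* v* e* , tips* , len* =
    chain W y ((W* , y*) ∷ rest*) (n , s , e , one , map₂ (tips* y) tip , v*) e* , (λ _ t → t) ,
    ≤o-trans (⊕-mono-≤o (≤o-refl {len0 W}) len*)
             (≤o-reflexive (sym (⊕-assoc (len0 W) (len0 W₁ ⊕ sumLen rest) (chainLen c))))

  trivial-or-chain : ∀ {x y} (w : Walk2 x y) → x ≡ y ⊎ Σ (Chain x y) λ c → chainLen c ≤o len2 w
  trivial-or-chain (trivial _) = inj₁ refl
  trivial-or-chain (zeroW (triv _)) = inj₁ refl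
  trivial-or-chain (zeroW {b = b} (step e f)) =
    inj₂ (chain (fin (step e f)) (inj₁ b) [] (s≤s z≤n , refl , refl) refl , ≤o-reflexive (⊕-identityʳ _))
  trivial-or-chain (oneW W y rest v e) = inj₂ (chain W y rest v e , ≤o-refl)

  Walk2-trans : ∀ {x y z} (w₁ : Walk2 x y) (w₂ : Walk2 y z) → Σ (Walk2 x z) λ w → len2 w ≤o (len2 w₁ ⊕ len2 w₂)
  Walk2-trans w₁ w₂ with trivial-or-chain w₁ | trivial-or-chain w₂
  ... | inj₁ refl | _ = w₂ , ⊕-mono-≤o (0≤o (len2 w₁)) ≤o-refl
  ... | inj₂ _ | inj₁ refl =
    w₁ , ≤o-trans (≤o-reflexive (sym (⊕-identityʳ (len2 w₁)))) (⊕-mono-≤o ≤o-refl (0≤o (len2 w₂)))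
  ... | inj₂ (chain W y rest v e , le₁) | inj₂ (c₂ , le₂) with catChain W y rest v e c₂
  ...   | c , _ , le = toWalk2 c , ≤o-trans le (⊕-mono-≤o le₁ le₂)

  reverse0 : Walk0 → Walk0
  reverse0 (fin f) = fin (reverseFin f)
  reverse0 (rayR r) = rayL r
  reverse0 (rayL r) = rayR r
  reverse0 (endless r s e) = endless s r (sym e)

  len0-reverse : ∀ W → len0 (reverse0 W) ≡ len0 W
  len0-reverse (fin f) = refl
  len0-reverse (rayR r) = refl
  len0-reverse (rayL r) = refl
  len0-reverse (endless r s e) = refl

  Valid1-reverse : ∀ {x y} W → Valid1 x W y [] → Valid1 y (reverse0 W) x []
  Valid1-reverse (fin f) (n , s , e) = n , e , s
  Valid1-reverse (rayR r) (n , s , e) = n , e , s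
  Valid1-reverse (rayL r) (n , s , e) = n , e , s
  Valid1-reverse (endless r s' _) (n , s , e) = n , e , s

  -- Appending the reversed first hop with Walk2-trans re-establishes the 1-node conditions.
  chain-sym : ∀ {x} W y rest → Valid1 x W y rest →
              Σ (Walk2 (final y rest) x) λ w → len2 w ≤o (len0 W ⊕ sumLen rest)
  chain-sym W y [] v =
    oneW (reverse0 W) _ [] (Valid1-reverse W v) refl , ≤o-reflexive (cong (_⊕ (0 , 0)) (len0-reverse W))
  chain-sym W y ((W₁ , y₁) ∷ rest) (n , s , e , _ , _ , v) with chain-sym W₁ y₁ rest v
  ... | w , le with Walk2-trans w (oneW (reverse0 W) _ [] (Valid1-reverse W (n , s , e)) refl)
  ...   | w' , le' =
    w' , ≤o-trans le' (≤o-trans (⊕-mono-≤o le (≤o-reflexive (trans (⊕-identityʳ _) (len0-reverse W))))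
                                (≤o-reflexive (⊕-comm _ (len0 W))))

  Walk2-sym : ∀ {x y} (w : Walk2 x y) → Σ (Walk2 y x) λ w' → len2 w' ≤o len2 w
  Walk2-sym (trivial x) = trivial x , ≤o-refl
  Walk2-sym (zeroW f) = zeroW (reverseFin f) , ≤o-refl
  Walk2-sym (oneW W y rest v refl) = chain-sym W y rest v

  Close : ℕ → Node → Node → Set
  Close k u v = Σ (Walk2 u v) λ w → lead (len2 w) ≤ k

  Close-sym : ∀ {k u v} → Close k u v → Close k v u
  Close-sym (w , w≤k) = proj₁ (Walk2-sym w) , ≤-trans (≤o⇒lead≤ (proj₂ (Walk2-sym w))) w≤k

  lead-len0≤2 : ∀ W → lead (len0 W) ≤ 2
  lead-len0≤2 (fin f) = z≤n
  lead-len0≤2 (rayR r) = s≤s z≤n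
  lead-len0≤2 (rayL r) = s≤s z≤n
  lead-len0≤2 (endless r s e) = ≤-refl

  hop : ∀ {x W y} rest → Valid1 x W y rest → Close 2 x y
  hop {W = W} rest v = oneW W _ [] (Valid1-head rest v) refl , ≤-trans (≤-reflexive (+-identityʳ _)) (lead-len0≤2 W)

  -- Minimise the lead coefficient first, then the finite part among walks of minimal lead.
  dist-exists : ∀ {a b} → Walk2 a b → ¬ ¬ Σ Ord (IsDist a b)
  dist-exists {a} {b} w₀ no-dist =
    ¬¬-least Lead (w₀ , refl) λ { (c , (w₁ , c≡) , c-min) →
    ¬¬-least (Rest c) (w₁ , cong (_, proj₂ (len2 w₁)) c≡) λ { (d , (w₂ , cd≡) , d-min) →
    no-dist ((c , d) , (w₂ , cd≡) , λ w → minimal c-min d-min w (m≤n⇒m<n∨m≡n (c-min _ (w , refl)))) } }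
    where
    Lead : ℕ → Set
    Lead c = Σ (Walk2 a b) λ w → lead (len2 w) ≡ c
    Rest : ℕ → ℕ → Set
    Rest c d = Σ (Walk2 a b) λ w → len2 w ≡ (c , d)
    minimal : ∀ {c d} → (∀ k → Lead k → c ≤ k) → (∀ k → Rest c k → d ≤ k) →
              (w : Walk2 a b) → c < lead (len2 w) ⊎ c ≡ lead (len2 w) → (c , d) ≤o len2 w
    minimal c-min d-min w (inj₁ lt) = inj₁ lt
    minimal c-min d-min w (inj₂ eq) = inj₂ (eq , d-min _ (w , cong (_, proj₂ (len2 w)) (sym eq)))

module Distance {G : Graph0} (H : Graph1 G) (F : FreeUltrafilter) where
  open Graph1 H
  open G1Defs H
  open Walks H
  open Ultrafilter F

  -- d(u, o) ≥ ω·t, phrased without assuming that the minimum defining d exists.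
  Far : ℕ → Node → Node → Set
  Far t u o = (w : Walk2 u o) → t ≤ lead (len2 w)

  Far-mono : ∀ {t t' u o} → t' ≤ t → Far t u o → Far t' u o
  Far-mono t'≤t far w = ≤-trans t'≤t (far w)

  Far? : ∀ t u o → Dec (Far t u o)
  Far? t u o with weak-excluded-middle (Far t u o)
  ... | inj₁ ¬far = no ¬far
  ... | inj₂ ¬¬far = yes λ w → decidable-stable (t ≤? lead (len2 w)) λ t≰ → ¬¬far λ far → t≰ (far w)

  short⇒¬Far : ∀ {t u o} (w : Walk2 u o) → lead (len2 w) < t → ¬ Far t u o
  short⇒¬Far w w<t far = <⇒≱ w<t (far w)

  ¬Far⇒¬¬short : ∀ {t u o} → ¬ Far t u o → ¬ ¬ Σ (Walk2 u o) λ w → lead (len2 w) < t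
  ¬Far⇒¬¬short ¬far no-short = ¬far λ w → ≮⇒≥ λ w<t → no-short (w , w<t)

  Far-shift : ∀ k t {u v o} → Far (k + t) u o → Close k u v → Far t v o
  Far-shift k t far (w , w≤k) w' with Walk2-trans w w'
  ... | c , c≤ = +-cancelˡ-≤ k t _ (≤-trans (far c) (≤-trans (≤o⇒lead≤ c≤) (+-monoˡ-≤ _ w≤k)))

  IsDist⇒Far : ∀ {u o α} → IsDist u o α → Far (lead α) u o
  IsDist⇒Far (_ , minimal) w = ≤o⇒lead≤ (minimal w)

  Far⇒≤IsDist : ∀ {t u o α} → Far t u o → IsDist u o α → t ≤ lead α
  Far⇒≤IsDist far ((w , refl) , _) = far w

  Far-hop : ∀ {t x W y o} rest → Valid1 x W y rest → Far (2 + t) x o → Far t y o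
  Far-hop {t} rest v far = Far-shift 2 t far (hop rest v)

  InShell : ℕ → Node → X1 → Set
  InShell t o x = Far t (inj₂ x) o × ¬ Far (3 + t) (inj₂ x) o

  climb : ∀ t {o y W z} rest → Valid1 y W z rest → IsOne y → ¬ Far (suc t) z o →
          Σ X1 (InShell t o) ⊎ ¬ Far t y o
  climb t {o} rest v (x , refl) ¬far with Far? t (inj₂ x) o
  ... | yes far = inj₁ (x , far , ¬far ∘ Far-hop rest v)
  ... | no ¬far-x = inj₂ ¬far-x

  -- The far 1-node closest to o along the walk lies in the shell, as its successor is not far.
  scan : ∀ t {o y W z} rest → Valid1 y W z rest → final z rest ≡ o → IsOne y →
         Σ X1 (InShell t o) ⊎ ¬ Far t y o
  scan t [] v refl one = climb t [] v one (short⇒¬Far (trivial _) (s≤s z≤n))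
  scan t ((W' , z') ∷ rest) v@(_ , _ , _ , one' , _ , v') fe one with scan t rest v' fe one'
  ... | inj₁ found = inj₁ found
  ... | inj₂ ¬far = climb t ((W' , z') ∷ rest) v one (¬far ∘ Far-mono (n≤1+n t))

  select : ∀ t {u o} → Walk2 u o → Σ X1 (InShell t o) ⊎ ¬ Far (3 + t) u o
  select t w@(trivial _) = inj₂ (short⇒¬Far w (s≤s z≤n))
  select t w@(zeroW _) = inj₂ (short⇒¬Far w (s≤s z≤n))
  select t w@(oneW W y [] v refl) = inj₂ (short⇒¬Far w (≤-trans (s≤s (proj₂ (hop [] v))) (m≤m+n 3 t)))
  select t (oneW W y ((W' , z) ∷ rest) v@(_ , _ , _ , one , _ , v') fe) with scan t rest v' fe one
  ... | inj₁ found = inj₁ found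
  ... | inj₂ ¬far = inj₂ (¬far ∘ Far-mono (n≤1+n t) ∘ Far-hop ((W' , z) ∷ rest) v)

module Galaxies {G : Graph0} (H : Graph1 G) (F : FreeUltrafilter) where
  open Graph1 H
  open G1Defs H
  open Enlargement F
  open FreeUltrafilter F
  open Ultrafilter F
  open Walks H
  open Distance H F

  at-standard : ∀ v n → at (standard v) n ≡ v
  at-standard (inj₁ u) n = refl
  at-standard (inj₂ x) n = refl

  LimDist⇒Close : ∀ {g g'} → LimDist g g' → Σ ℕ λ k → mem (λ n → Close k (at g n) (at g' n))
  LimDist⇒Close (k , near) = k , mem-mono near λ { n (_ , ((w , refl) , _) , w≤k) → w , ≤o⇒lead≤ w≤k }

  LimDist-refl : ∀ g → LimDist g g
  LimDist-refl g = 0 , mem-mono mem-univ λ _ _ → (0 , 0) , ((trivial _ , refl) , λ w → 0≤o _) , ≤o-refl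

  short⇒¬¬IsDist : ∀ {k u v} (w : Walk2 u v) → lead (len2 w) < k →
                   ¬ ¬ Σ Ord λ α → IsDist v u α × α ≤o ω· k
  short⇒¬¬IsDist w w<k no-dist with Walk2-sym w
  ... | w' , w'≤w = dist-exists w' λ { (α , dist) →
    no-dist (α , dist , inj₁ (≤-<-trans (≤o⇒lead≤ (≤o-trans (proj₂ dist w') w'≤w)) w<k)) }

  module Construction (connected : Wconnected) (x₁ : X1) (h : HyperNode) (h∉Γ₀ : ¬ InΓ₀ h) where
    o : Node
    o = at h 0

    path : ∀ n → Walk2 (at h n) o
    path n = connected (at h n) o

    h-far : ∀ k → mem (λ n → Far k (at h n) o)
    h-far k = ¬mem∁⇒mem _ λ near → h∉Γ₀ (o , k , ¬mem∁⇒mem _ λ notClose →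
      mem-inhabited (mem-∧ near notClose) λ n (¬far , ¬close) →
        ¬Far⇒¬¬short ¬far λ (w , w<k) → short⇒¬¬IsDist w w<k λ (α , dist , α≤k) →
          ¬close (α , subst (λ v → IsDist v (at h n) α) (sym (at-standard o n)) dist , α≤k))

    -- The selection may fail off a filter set, so a fixed 1-node serves as a default.
    shellNode : ℕ → ℕ → X1
    shellNode t n with select t (path n)
    ... | inj₁ (x , _) = x
    ... | inj₂ _ = x₁

    shellNode-inShell : ∀ t n → Far (3 + t) (at h n) o → InShell t o (shellNode t n)
    shellNode-inShell t n far with select t (path n)
    ... | inj₁ (_ , inShell) = inShell
    ... | inj₂ ¬far = ⊥-elim (¬far far)

    -- The walk path n bounds the search, since Far t (at h n) o forces t ≤ lead (len2 (path n)).
    scaleSpec : ∀ n → Σ ℕ λ s → Far (4 * (s * s)) (at h n) o ×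
                (∀ M → Far (4 * (M * M)) (at h n) o → M ≤ lead (len2 (path n)) → M ≤ s)
    scaleSpec n =
      greatest≤ (λ s → Far (4 * (s * s)) (at h n) o) (λ s → Far? _ _ _) (λ _ → z≤n) (lead (len2 (path n)))

    scale : ℕ → ℕ
    scale n = proj₁ (scaleSpec n)

    scale-large : ∀ M → mem (λ n → M ≤ scale n)
    scale-large M = mem-mono (h-far (4 * (M * M))) λ n far →
      proj₂ (proj₂ (scaleSpec n)) M far (≤-trans (n≤4n² M) (far (path n)))

    γ : ℤ → ℕ → X1
    γ i n = shellNode (radius (scale n) i) n

    Γ : ℤ → HyperNode
    Γ i = inj₂ (γ i)

    γ-inShell : ∀ i {n} → Spacious i (scale n) → InShell (radius (scale n) i) o (γ i n)
    γ-inShell i {n} sp = shellNode-inShell _ n (Far-mono (radius-bounded i sp) (proj₁ (proj₂ (scaleSpec n))))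

    γ-isolated : ∀ i {k n} v → Spacious i (scale n) → k + suc (lead (len2 (connected v o))) ≤ scale n →
                 ¬ Close k v (inj₂ (γ i n))
    γ-isolated i {k} v sp large c =
      1+n≰n (Far-shift k (suc _) (Far-mono (≤-trans large (s≤radius i sp)) (proj₁ (γ-inShell i sp))) (Close-sym c)
               (connected v o))

    Γ-outside-Γ₀ : ∀ i → ¬ InΓ₀ (Γ i)
    Γ-outside-Γ₀ i (v , lim) with LimDist⇒Close lim
    ... | k , close =
      mem-inhabited (mem-∧ close (mem-∧ (scale-large _) (scale-large (k + suc (lead (len2 (connected v o)))))))
        λ n (c , sp , large) → γ-isolated i v sp large (subst (λ u → Close k u _) (at-standard v n) c)

    Roomy : ℤ → ℤ → ℕ → ℕ → Set
    Roomy i j k n = Spacious i (scale n) × Spacious j (scale n) × k + 3 ≤ scale n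

    eventually-roomy : ∀ i j k → mem (Roomy i j k)
    eventually-roomy i j k = mem-∧ (scale-large _) (mem-∧ (scale-large _) (scale-large _))

    γ-apart : ∀ {i j k n} → i <ℤ j → Roomy i j k n → ¬ Close k (inj₂ (γ j n)) (inj₂ (γ i n))
    γ-apart {i} {j} {k} i<j (spᵢ , spⱼ , large) c =
      proj₂ (γ-inShell i spᵢ)
        (Far-shift k _ (Far-mono (radius-separated i<j spᵢ large) (proj₁ (γ-inShell j spⱼ))) c)

    Γ-apart : ∀ i j → i ≢ j → ¬ LimDist (Γ i) (Γ j)
    Γ-apart i j i≢j lim with LimDist⇒Close lim | ℤ.<-cmp i j
    ... | _ | tri≈ _ i≡j _ = i≢j i≡j
    ... | k , close | tri< i<j _ _ =
      mem-inhabited (mem-∧ close (eventually-roomy i j k)) λ n (c , roomy) → γ-apart i<j roomy (Close-sym c)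
    ... | k , close | tri> _ _ j<i =
      mem-inhabited (mem-∧ close (eventually-roomy i j k)) λ n (c , spᵢ , spⱼ , large) →
        γ-apart j<i (spⱼ , spᵢ , large) c

    Separated : ℕ → ℤ → ℤ → ℕ → Node → Set
    Separated m i j n v = Σ Ord λ α → Σ Ord λ β →
      IsDist (inj₂ (γ j n)) v α × IsDist (inj₂ (γ i n)) v β × (β ⊕ ω· m) ≤o α

    γ-lead-gap : ∀ {i j m n α β} → i <ℤ j → Roomy i j m n →
                 IsDist (inj₂ (γ j n)) o α → IsDist (inj₂ (γ i n)) o β → lead β + m < lead α
    γ-lead-gap {i} {j} {m} {n} {α} {β} i<j (spᵢ , spⱼ , large) distⱼ distᵢ = begin-strict
      lead β + m      <⟨ +-monoˡ-< m β-near ⟩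
      3 + rᵢ + m      ≡⟨ +-comm (3 + rᵢ) m ⟩
      m + (3 + rᵢ)    ≤⟨ radius-separated i<j spᵢ large ⟩
      radius (scale n) j ≤⟨ Far⇒≤IsDist (proj₁ (γ-inShell j spⱼ)) distⱼ ⟩
      lead α          ∎
      where
      open ≤-Reasoning
      rᵢ = radius (scale n) i
      β-near : lead β < 3 + rᵢ
      β-near = ≰⇒> λ 3+rᵢ≤β → proj₂ (γ-inShell i spᵢ) (Far-mono 3+rᵢ≤β (IsDist⇒Far distᵢ))

    γ-separated : ∀ {i j m n} → i <ℤ j → Roomy i j m n → ¬ ¬ Separated m i j n o
    γ-separated {i} {j} {m} {n} i<j roomy not-separated =
      dist-exists (connected (inj₂ (γ j n)) o) λ (α , distⱼ) →
      dist-exists (connected (inj₂ (γ i n)) o) λ (β , distᵢ) →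
      not-separated (α , β , distⱼ , distᵢ , inj₁ (γ-lead-gap i<j roomy distⱼ distᵢ))

    Γ-closer : ∀ i j → i <ℤ j → Closer (Γ i) (Γ j)
    Γ-closer i j i<j =
      Γ i , Γ j , standard o , LimDist-refl (Γ i) , LimDist-refl (Γ j) , (o , LimDist-refl (standard o)) ,
      λ m → ¬mem∁⇒mem _ λ ¬sep →
        mem-inhabited (mem-∧ ¬sep (eventually-roomy i j m)) λ n (¬sep-n , roomy) →
          γ-separated i<j roomy (¬sep-n ∘ subst (Separated m i j n) (sym (at-standard o n)))

theorem11p2 : (G : Graph0) (H : Graph1 G) (F : FreeUltrafilter) →
    let open G1Defs H in
    let open Enlargement F in
    Wconnected → InfinitelyManyBoundary →
    Σ HyperNode (λ h → ¬ InΓ₀ h) →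
    Σ (ℤ → HyperNode) (λ Γ →
      (∀ i → ¬ InΓ₀ (Γ i)) ×
      (∀ i j → i ≢ j → ¬ LimDist (Γ i) (Γ j)) ×
      (∀ i j → i <ℤ j → Closer (Γ i) (Γ j)))
theorem11p2 G H F connected boundary (h , h∉Γ₀) = Γ , Γ-outside-Γ₀ , Γ-apart , Γ-closer
  where open Galaxies.Construction H F connected (proj₁ (boundary [])) h h∉Γ₀
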